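{- Let $F,a\in\mathbb{N}$. There is a reflective numerical semigroup $S$ with Frobenius number $F(S)=F$ and multiplicity $m(S)=a$ if and only if the following three conditions hold: (1) $2\le a\le F+1$; (2) $a\nmid F$; and (3) $\lfloor F/a\rfloor$ is even.
   Context: A numerical semigroup is a submonoid $S$ of $(\mathbb{N}_0,+)$ with finite complement; $g(S)=\#(\mathbb{N}_0\setminus S)$, $m(S)$ is its smallest positive element, and (for $g(S)\ge1$) $F(S)$ is the largest element of $\mathbb{N}_0\setminus S$. $S$ (with $g=g(S)\ge1$) is reflective if for every integer $z$ with $0\le z\le g-1$ exactly one of $z$ and $z+g$ lies in $S$. -}

module Defs where

open import Data.Nat using (ℕ; zero; suc; _+_; _≤_; _<_)
import Data.Nat
open import Data.Bool using (Bool; true; false; T; not; _xor_)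
open import Data.Product using (Σ; _×_; ∃)
open import Relation.Binary.PropositionalEquality using (_≡_)

record NumericalSemigroup : Set where
  field
    mem       : ℕ → Bool
    zero-mem  : T (mem 0)
    add-mem   : ∀ x y → T (mem x) → T (mem y) → T (mem (x + y))
    bound     : ℕ
    cofinite  : ∀ n → bound ≤ n → T (mem n)

  gapsBelow : ℕ → ℕ
  gapsBelow zero    = 0
  gapsBelow (suc k) with mem k
  ... | true  = gapsBelow k
  ... | false = suc (gapsBelow k)

  -- genus g(S) = #(ℕ \ S); all gaps lie below `bound`
  genus : ℕ
  genus = gapsBelow bound

open NumericalSemigroup public

_∈S_ : ℕ → NumericalSemigroup → Set
n ∈S S = T (mem S n)

IsFrobenius : NumericalSemigroup → ℕ → Set
IsFrobenius S F = (¬T (mem S F)) × (∀ n → F < n → n ∈S S)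
  where
  ¬T : Bool → Set
  ¬T b = T (not b)

IsMultiplicity : NumericalSemigroup → ℕ → Set
IsMultiplicity S a = (0 < a) × (a ∈S S) × (∀ n → 0 < n → n < a → T (not (mem S n)))

Reflective : NumericalSemigroup → Set
Reflective S = (1 ≤ genus S) × (∀ z → z < genus S → T (mem S z xor mem S (z + genus S)))

-- ⌊F / a⌋ (only used when a ≥ 2; for a = 0 it returns 0 by convention)
floorDiv : ℕ → ℕ → ℕ
floorDiv F zero    = 0
floorDiv F (suc k) = F Data.Nat./ suc k

{-# OPTIONS --safe #-}
module Submission where

-- Each z < g contributes exactly one gap among z and z + g, so a reflective
-- semigroup has all of its gaps below 2g; hence g ≤ F < 2g and M = F − g is an
-- element of S below g. Below g, S contains only multiples of the multiplicity a:
-- if r + k a (0 < r < a) is a gap then r + k a + g ∈ S, so r + (k + 1) a + g ∈ S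
-- and r + (k + 1) a is a gap again. Thus M = k a, and g < M + a because M + a ∈ S
-- but M + a ≠ g and M + a + g > F. So F = 2 k a + r with r < a, and ⌊F/a⌋ = 2 k.
-- Conversely, for F = 2 h a + r with 0 < r < a put g = h a + r; the multiples of a
-- below g, the x ∈ [g, 2g) with a ∤ x − g, and all x ≥ 2g form a reflective
-- numerical semigroup of genus g, Frobenius number g + h a = F and multiplicity a.

open import Defs
open import Data.Bool using (Bool; true; false; T; not; _xor_; if_then_else_)
open import Data.Bool.Properties using (not-involutive)
open import Data.Nat
open import Data.Nat.Properties
open import Data.Nat.Divisibility
open import Data.Nat.DivMod
open import Data.Nat.Tactic.RingSolver using (solve-∀)
open import Data.Product using (Σ; _×_; _,_; proj₁; proj₂)
open import Data.Sum using (_⊎_; inj₁; inj₂; [_,_]′)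
open import Data.Unit using (tt)
open import Function.Base using (_∘_)
open import Function.Bundles using (_⇔_; mk⇔)
open import Relation.Nullary using (¬_; yes; no; contradiction)
open import Relation.Nullary.Decidable
  using (isYes; toSum; fromWitness; toWitness; fromWitnessFalse; toWitnessFalse)
open import Relation.Binary.PropositionalEquality
  using (_≡_; _≢_; refl; sym; trans; cong; cong₂; subst; module ≡-Reasoning)

_∉S_ : ℕ → NumericalSemigroup → Set
n ∉S S = T (not (mem S n))

T-not⇒¬T : ∀ {b} → T (not b) → ¬ T b
T-not⇒¬T {false} _ ()

T-or-T-not : ∀ b → T b ⊎ T (not b)
T-or-T-not true  = inj₁ tt
T-or-T-not false = inj₂ tt

xor-trueˡ : ∀ b c → T b → T (b xor c) → T (not c)
xor-trueˡ true c _ t = t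

xor-falseˡ : ∀ b c → T (not b) → T (b xor c) → T c
xor-falseˡ false c _ t = t

xor-trueʳ : ∀ b c → T c → T (b xor c) → T (not b)
xor-trueʳ false c    _ _  = tt
xor-trueʳ true  true _ ()

xor-falseʳ : ∀ b c → T (not c) → T (b xor c) → T b
xor-falseʳ true  c     _ _  = tt
xor-falseʳ false false _ ()

true-xor-false : ∀ b c → T b → T (not c) → T (b xor c)
true-xor-false true c _ t = t

false-xor-true : ∀ b c → T (not b) → T c → T (b xor c)
false-xor-true false c _ t = t

module _ (S : NumericalSemigroup) where

  gapsBelow-∈ : ∀ {k} → k ∈S S → gapsBelow S (suc k) ≡ gapsBelow S k
  gapsBelow-∈ {k} _ with mem S k
  ... | true = refl

  gapsBelow-∉ : ∀ {k} → k ∉S S → gapsBelow S (suc k) ≡ suc (gapsBelow S k)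
  gapsBelow-∉ {k} _ with mem S k
  ... | false = refl

  gapsBelow-step : ∀ k → gapsBelow S k ≤ gapsBelow S (suc k)
  gapsBelow-step k with mem S k
  ... | true  = ≤-refl
  ... | false = n≤1+n _

  gapsBelow-mono : ∀ {m n} → m ≤ n → gapsBelow S m ≤ gapsBelow S n
  gapsBelow-mono {n = zero}  z≤n = ≤-refl
  gapsBelow-mono {n = suc n} m≤1+n with m≤n⇒m<n∨m≡n m≤1+n
  ... | inj₁ m<1+n = ≤-trans (gapsBelow-mono (s≤s⁻¹ m<1+n)) (gapsBelow-step n)
  ... | inj₂ refl  = ≤-refl

  gap<bound : ∀ {n} → n ∉S S → n < bound S
  gap<bound {n} n∉S = ≰⇒> (λ bound≤n → T-not⇒¬T n∉S (cofinite S n bound≤n))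

  gapsBelow-gap<genus : ∀ {n} → n ∉S S → gapsBelow S n < genus S
  gapsBelow-gap<genus n∉S =
    subst (_≤ genus S) (gapsBelow-∉ n∉S) (gapsBelow-mono (gap<bound n∉S))

  module _ {g : ℕ} (exactly-one : ∀ z → z < g → T (mem S z xor mem S (z + g))) where

    gapsBelow-shift : ∀ {k} → k ≤ g →
                      gapsBelow S (k + g) + gapsBelow S k ≡ gapsBelow S g + k
    gapsBelow-shift {zero}  _     = refl
    gapsBelow-shift {suc k} k<g with T-or-T-not (mem S k)
    ... | inj₁ k∈S = begin
      gapsBelow S (suc k + g) + gapsBelow S (suc k)
        ≡⟨ cong₂ _+_ (gapsBelow-∉ (xor-trueˡ _ _ k∈S (exactly-one k k<g)))
                     (gapsBelow-∈ k∈S) ⟩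
      suc (gapsBelow S (k + g) + gapsBelow S k)
        ≡⟨ cong suc (gapsBelow-shift (<⇒≤ k<g)) ⟩
      suc (gapsBelow S g + k)
        ≡⟨ +-suc _ k ⟨
      gapsBelow S g + suc k ∎
      where open ≡-Reasoning
    ... | inj₂ k∉S = begin
      gapsBelow S (suc k + g) + gapsBelow S (suc k)
        ≡⟨ cong₂ _+_ (gapsBelow-∈ (xor-falseˡ _ _ k∉S (exactly-one k k<g)))
                     (gapsBelow-∉ k∉S) ⟩
      gapsBelow S (k + g) + suc (gapsBelow S k)
        ≡⟨ +-suc _ _ ⟩
      suc (gapsBelow S (k + g) + gapsBelow S k)
        ≡⟨ cong suc (gapsBelow-shift (<⇒≤ k<g)) ⟩
      suc (gapsBelow S g + k)
        ≡⟨ +-suc _ k ⟨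
      gapsBelow S g + suc k ∎
      where open ≡-Reasoning

    gapsBelow-double : gapsBelow S (g + g) ≡ g
    gapsBelow-double =
      +-cancelʳ-≡ (gapsBelow S g) _ _ (trans (gapsBelow-shift ≤-refl) (+-comm _ g))

  *-∈S : ∀ {a} → a ∈S S → ∀ k → (k * a) ∈S S
  *-∈S _   zero    = zero-mem S
  *-∈S a∈S (suc k) = add-mem S _ _ a∈S (*-∈S a∈S k)

  gap≤frobenius : ∀ {F n} → IsFrobenius S F → n ∉S S → n ≤ F
  gap≤frobenius (_ , above) n∉S = ≮⇒≥ (λ F<n → T-not⇒¬T n∉S (above _ F<n))

  frobenius-∤ : ∀ {F a} → IsFrobenius S F → a ∈S S → ¬ a ∣ F
  frobenius-∤ (F∉S , _) a∈S (divides k refl) = T-not⇒¬T F∉S (*-∈S a∈S k)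

  multiplicity≤frobenius+1 : ∀ {F a} → IsFrobenius S F → IsMultiplicity S a → a ≤ F + 1
  multiplicity≤frobenius+1 {F} (_ , above) (_ , _ , below) = ≮⇒≥ λ F+1<a →
    T-not⇒¬T (below (F + 1) (m≤n+m 1 F) F+1<a) (above (F + 1) (m<m+n F z<s))

  multiplicity≥2 : ∀ {a n} → IsMultiplicity S a → n ∉S S → 2 ≤ a
  multiplicity≥2 {zero}          (() , _)       _
  multiplicity≥2 {suc zero} {n} (_ , 1∈S , _) n∉S =
    contradiction (subst (_∈S S) (*-identityʳ n) (*-∈S 1∈S n)) (T-not⇒¬T n∉S)
  multiplicity≥2 {suc (suc _)} _ _ = s≤s (s≤s z≤n)

floorDiv-*+ : ∀ k {a r} → r < a → floorDiv (k * a + r) a ≡ k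
floorDiv-*+ k {a@(suc _)} {r} r<a = begin
  (k * a + r) / a      ≡⟨ +-distrib-/-∣ˡ r (divides k refl) ⟩
  k * a / a + r / a    ≡⟨ cong₂ _+_ (m*n/n≡m k a) (m<n⇒m/n≡0 r<a) ⟩
  k + 0                ≡⟨ +-identityʳ k ⟩
  k                    ∎
  where open ≡-Reasoning

floorDiv-even : ∀ {a m n} → a ∣ m → m ≤ n → n < m + a → 2 ∣ floorDiv (m + n) a
floorDiv-even {a} {n = n} (divides k refl) m≤n n<m+a = divides k (begin
  floorDiv (k * a + n) a                     ≡⟨ cong (λ x → floorDiv x a) m+n≡ ⟩
  floorDiv (k * 2 * a + (n ∸ k * a)) a       ≡⟨ floorDiv-*+ (k * 2) r<a ⟩
  k * 2                                      ∎)
  where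
  open ≡-Reasoning
  n≡m+r : n ≡ k * a + (n ∸ k * a)
  n≡m+r = sym (m+[n∸m]≡n m≤n)
  r<a : n ∸ k * a < a
  r<a = +-cancelˡ-< (k * a) _ _ (subst (_< k * a + a) n≡m+r n<m+a)
  m+n≡ : k * a + n ≡ k * 2 * a + (n ∸ k * a)
  m+n≡ = trans (cong (k * a +_) n≡m+r) (double k a (n ∸ k * a))
    where
    double : ∀ k a r → k * a + (k * a + r) ≡ k * 2 * a + r
    double = solve-∀

module _ {S : NumericalSemigroup} (reflective : Reflective S) where

  private
    g : ℕ
    g = genus S

    exactly-one : ∀ z → z < g → T (mem S z xor mem S (z + g))
    exactly-one = proj₂ reflective

  genus-∉ : g ∉S S
  genus-∉ = xor-trueˡ _ _ (zero-mem S) (exactly-one 0 (proj₁ reflective))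

  frobenius<2*genus : ∀ {F} → IsFrobenius S F → F < g + g
  frobenius<2*genus {F} (F∉S , _) = ≰⇒> λ 2g≤F → <-irrefl refl (begin-strict
    g                    ≡⟨ gapsBelow-double S exactly-one ⟨
    gapsBelow S (g + g)  ≤⟨ gapsBelow-mono S 2g≤F ⟩
    gapsBelow S F        <⟨ gapsBelow-gap<genus S F∉S ⟩
    g                    ∎)
    where open ≤-Reasoning

  residue-∉ : ∀ {a r} → IsMultiplicity S a → 0 < r → r < a →
              ∀ k → r + k * a < g → (r + k * a) ∉S S
  residue-∉ {r = r} (_ , _ , below) 0<r r<a zero _ =
    subst (_∉S S) (sym (+-identityʳ r)) (below r 0<r r<a)
  residue-∉ {a} {r} mult@(0<a , a∈S , _) 0<r r<a (suc k) z<g =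
    xor-trueʳ _ _ z+g∈S (exactly-one z z<g)
    where
    z′ z : ℕ
    z′ = r + k * a
    z  = r + suc k * a
    z′<g : z′ < g
    z′<g = <-trans (+-monoʳ-< r (m<n+m (k * a) 0<a)) z<g
    z′+g∈S : (z′ + g) ∈S S
    z′+g∈S = xor-falseˡ _ _ (residue-∉ mult 0<r r<a k z′<g) (exactly-one z′ z′<g)
    z+g∈S : (z + g) ∈S S
    z+g∈S = subst (_∈S S) (shift r k a g) (add-mem S _ _ z′+g∈S a∈S)
      where
      shift : ∀ r k a g → r + k * a + g + a ≡ r + (a + k * a) + g
      shift = solve-∀

  ∈-below-genus⇒∣ : ∀ {a z} → IsMultiplicity S a → z < g → z ∈S S → a ∣ z
  ∈-below-genus⇒∣ {zero} (() , _) _ _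
  ∈-below-genus⇒∣ {a@(suc _)} {z} mult z<g z∈S with z % a ≟ 0
  ... | yes z%a≡0 = m%n≡0⇒n∣m z a z%a≡0
  ... | no  z%a≢0 = contradiction (subst (_∈S S) z≡ z∈S) (T-not⇒¬T
    (residue-∉ mult (n≢0⇒n>0 z%a≢0) (m%n<n z a) (z / a) (subst (_< g) z≡ z<g)))
    where
    z≡ : z ≡ z % a + z / a * a
    z≡ = m≡m%n+[m/n]*n z a

  module _ {F : ℕ} (frobenius : IsFrobenius S F) where

    private
      M : ℕ
      M = F ∸ g

      M+g≡F : M + g ≡ F
      M+g≡F = m∸n+n≡m (gap≤frobenius S frobenius genus-∉)

    frobenius∸genus<genus : M < g
    frobenius∸genus<genus =
      +-cancelʳ-< g M g (subst (_< g + g) (sym M+g≡F) (frobenius<2*genus frobenius))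

    frobenius∸genus-∈ : M ∈S S
    frobenius∸genus-∈ =
      xor-falseʳ _ _ (subst (_∉S S) (sym M+g≡F) (proj₁ frobenius))
        (exactly-one M frobenius∸genus<genus)

    genus<frobenius∸genus+multiplicity : ∀ {a} → IsMultiplicity S a → g < M + a
    genus<frobenius∸genus+multiplicity {a} (0<a , a∈S , _) =
      ≰⇒> λ M+a≤g → [ M+a≮g , M+a≢g ]′ (m≤n⇒m<n∨m≡n M+a≤g)
      where
      M+a∈S : (M + a) ∈S S
      M+a∈S = add-mem S M a frobenius∸genus-∈ a∈S
      M+a≮g : ¬ M + a < g
      M+a≮g M+a<g = T-not⇒¬T
        (xor-trueˡ _ _ M+a∈S (exactly-one (M + a) M+a<g))
        (proj₂ frobenius (M + a + g)
          (subst (_< M + a + g) M+g≡F (+-monoˡ-< g (m<m+n M 0<a))))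
      M+a≢g : M + a ≢ g
      M+a≢g M+a≡g = T-not⇒¬T genus-∉ (subst (_∈S S) M+a≡g M+a∈S)

    reflective⇒conditions : ∀ {a} → IsMultiplicity S a →
      (2 ≤ a × a ≤ F + 1) × ¬ a ∣ F × 2 ∣ floorDiv F a
    reflective⇒conditions {a} mult@(_ , a∈S , _) =
      (multiplicity≥2 S mult genus-∉ , multiplicity≤frobenius+1 S frobenius mult) ,
      frobenius-∤ S frobenius a∈S ,
      subst (λ n → 2 ∣ floorDiv n a) M+g≡F
        (floorDiv-even (∈-below-genus⇒∣ mult frobenius∸genus<genus frobenius∸genus-∈)
          (<⇒≤ frobenius∸genus<genus) (genus<frobenius∸genus+multiplicity mult))

∤-between : ∀ k {a n} → k * a < n → n < k * a + a → ¬ a ∣ n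
∤-between k {a} ka<qa qa<ka+a (divides q refl) = <⇒≱ k<q (s≤s⁻¹ q<1+k)
  where
  k<q : k < q
  k<q = *-cancelʳ-< a k q ka<qa
  q<1+k : q < suc k
  q<1+k = *-cancelʳ-< a q (suc k) (subst (q * a <_) (+-comm (k * a) a) qa<ka+a)

module Construction (a g : ℕ) (a∤g : ¬ a ∣ g) where

  member : ℕ → Bool
  member x = if isYes (x <? g) then isYes (a ∣? x)
             else if isYes (x <? g + g) then not (isYes (a ∣? (x ∸ g)))
             else true

  member-low : ∀ {x} → x < g → member x ≡ isYes (a ∣? x)
  member-low {x} x<g with x <? g
  ... | yes _   = refl
  ... | no  x≮g = contradiction x<g x≮g

  member-mid : ∀ {x} → g ≤ x → x < g + g → member x ≡ not (isYes (a ∣? (x ∸ g)))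
  member-mid {x} g≤x x<2g with x <? g | x <? g + g
  ... | yes x<g | _        = contradiction g≤x (<⇒≱ x<g)
  ... | no _    | yes _    = refl
  ... | no _    | no x≮2g  = contradiction x<2g x≮2g

  member-high : ∀ {x} → g + g ≤ x → member x ≡ true
  member-high {x} 2g≤x with x <? g | x <? g + g
  ... | yes x<g | _       = contradiction (≤-trans (m≤m+n g g) 2g≤x) (<⇒≱ x<g)
  ... | no _    | yes x<2g = contradiction 2g≤x (<⇒≱ x<2g)
  ... | no _    | no _     = refl

  low-∈ : ∀ {x} → x < g → a ∣ x → T (member x)
  low-∈ x<g a∣x = subst T (sym (member-low x<g)) (fromWitness a∣x)

  low-∉ : ∀ {x} → x < g → ¬ a ∣ x → T (not (member x))
  low-∉ x<g a∤x = subst (T ∘ not) (sym (member-low x<g)) (fromWitnessFalse a∤x)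

  low-∈⇒∣ : ∀ {x} → x < g → T (member x) → a ∣ x
  low-∈⇒∣ x<g x∈ = toWitness (subst T (member-low x<g) x∈)

  mid-∈ : ∀ {x} → g ≤ x → x < g + g → ¬ a ∣ (x ∸ g) → T (member x)
  mid-∈ g≤x x<2g a∤ = subst T (sym (member-mid g≤x x<2g)) (fromWitnessFalse a∤)

  mid-∉ : ∀ {x} → g ≤ x → x < g + g → a ∣ (x ∸ g) → T (not (member x))
  mid-∉ g≤x x<2g a∣ = subst (T ∘ not) (sym (member-mid g≤x x<2g))
    (subst T (sym (not-involutive _)) (fromWitness a∣))

  mid-∈⇒∤ : ∀ {x} → g ≤ x → x < g + g → T (member x) → ¬ a ∣ (x ∸ g)
  mid-∈⇒∤ g≤x x<2g x∈ = toWitnessFalse (subst T (member-mid g≤x x<2g) x∈)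

  high-∈ : ∀ {x} → g + g ≤ x → T (member x)
  high-∈ 2g≤x = subst T (sym (member-high 2g≤x)) tt

  multiple-∈ : ∀ {x} → a ∣ x → T (member x)
  multiple-∈ {x} a∣x with <-≤-connex x g | <-≤-connex x (g + g)
  ... | inj₁ x<g | _         = low-∈ x<g a∣x
  ... | inj₂ _   | inj₂ 2g≤x = high-∈ 2g≤x
  ... | inj₂ g≤x | inj₁ x<2g = mid-∈ g≤x x<2g λ a∣x∸g →
    a∤g (∣m+n∣m⇒∣n (subst (a ∣_) (sym (m∸n+n≡m g≤x)) a∣x) a∣x∸g)

  multiple-+-∈ : ∀ {d y} → a ∣ d → T (member y) → T (member (d + y))
  multiple-+-∈ {d} {y} a∣d y∈ with <-≤-connex y g | <-≤-connex (d + y) (g + g)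
  ... | inj₁ y<g | _             = multiple-∈ (∣m∣n⇒∣m+n a∣d (low-∈⇒∣ y<g y∈))
  ... | inj₂ _   | inj₂ 2g≤d+y   = high-∈ 2g≤d+y
  ... | inj₂ g≤y | inj₁ d+y<2g =
    mid-∈ (≤-trans g≤y (m≤n+m y d)) d+y<2g λ a∣d+y∸g →
      mid-∈⇒∤ g≤y (≤-<-trans (m≤n+m y d) d+y<2g) y∈
        (∣m+n∣m⇒∣n (subst (a ∣_) (+-∸-assoc d g≤y) a∣d+y∸g) a∣d)

  member-+ : ∀ x y → T (member x) → T (member y) → T (member (x + y))
  member-+ x y x∈ y∈ with <-≤-connex x g | <-≤-connex y g
  ... | inj₁ x<g | _        = multiple-+-∈ (low-∈⇒∣ x<g x∈) y∈
  ... | inj₂ _   | inj₁ y<g =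
    subst (T ∘ member) (+-comm y x) (multiple-+-∈ (low-∈⇒∣ y<g y∈) x∈)
  ... | inj₂ g≤x | inj₂ g≤y = high-∈ (+-mono-≤ g≤x g≤y)

  semigroup : NumericalSemigroup
  semigroup = record
    { mem      = member
    ; zero-mem = multiple-∈ (a ∣0)
    ; add-mem  = member-+
    ; bound    = g + g
    ; cofinite = λ _ → high-∈
    }

  shifted-∉ : ∀ {z} → z < g → a ∣ z → T (not (member (z + g)))
  shifted-∉ {z} z<g a∣z =
    mid-∉ (m≤n+m g z) (+-monoˡ-< g z<g) (subst (a ∣_) (sym (m+n∸n≡m z g)) a∣z)

  shifted-∈ : ∀ {z} → z < g → ¬ a ∣ z → T (member (z + g))
  shifted-∈ {z} z<g a∤z =
    mid-∈ (m≤n+m g z) (+-monoˡ-< g z<g) (a∤z ∘ subst (a ∣_) (m+n∸n≡m z g))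

  exactly-one : ∀ z → z < g → T (member z xor member (z + g))
  exactly-one z z<g with toSum (a ∣? z)
  ... | inj₁ a∣z = true-xor-false _ _ (low-∈ z<g a∣z) (shifted-∉ z<g a∣z)
  ... | inj₂ a∤z = false-xor-true _ _ (low-∉ z<g a∤z) (shifted-∈ z<g a∤z)

  genus-semigroup : genus semigroup ≡ g
  genus-semigroup = gapsBelow-double semigroup exactly-one

  reflective : Reflective semigroup
  reflective rewrite genus-semigroup = n≢0⇒n>0 (λ { refl → a∤g (a ∣0) }) , exactly-one

  frobenius : ∀ h → h * a < g → g < h * a + a → IsFrobenius semigroup (g + h * a)
  frobenius h ha<g g<ha+a =
    mid-∉ (m≤m+n g (h * a)) (+-monoʳ-< g ha<g)
      (subst (a ∣_) (sym (m+n∸m≡n g (h * a))) (divides h refl)) ,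
    above
    where
    above : ∀ n → g + h * a < n → T (member n)
    above n F<n with <-≤-connex n (g + g)
    ... | inj₂ 2g≤n = high-∈ 2g≤n
    ... | inj₁ n<2g = mid-∈ g≤n n<2g (∤-between h ha<n∸g n∸g<ha+a)
      where
      g≤n : g ≤ n
      g≤n = ≤-trans (m≤m+n g (h * a)) (<⇒≤ F<n)
      g+[n∸g]≡n : g + (n ∸ g) ≡ n
      g+[n∸g]≡n = m+[n∸m]≡n g≤n
      ha<n∸g : h * a < n ∸ g
      ha<n∸g = +-cancelˡ-< g (h * a) (n ∸ g) (subst (g + h * a <_) (sym g+[n∸g]≡n) F<n)
      n∸g<ha+a : n ∸ g < h * a + a
      n∸g<ha+a =
        <-trans (+-cancelˡ-< g (n ∸ g) g (subst (_< g + g) (sym g+[n∸g]≡n) n<2g)) g<ha+a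

  multiplicity : 0 < a → a ≤ suc g → IsMultiplicity semigroup a
  multiplicity 0<a a≤1+g = 0<a , multiple-∈ ∣-refl , below
    where
    below : ∀ n → 0 < n → n < a → T (not (member n))
    below n@(suc _) _ n<a with m≤n⇒m<n∨m≡n (s≤s⁻¹ (≤-trans n<a a≤1+g))
    ... | inj₁ n<g = low-∉ n<g (>⇒∤ n<a)
    ... | inj₂ refl = mid-∉ ≤-refl (m<m+n g z<s) (subst (a ∣_) (sym (n∸n≡0 g)) (a ∣0))

a≤g+h*a+1⇒a≤1+g : ∀ h {a g} → h * a ≤ g → a ≤ g + h * a + 1 → a ≤ suc g
a≤g+h*a+1⇒a≤1+g zero    {a} {g} _ a≤g+1 =
  subst (a ≤_) (trans (cong (_+ 1) (+-identityʳ g)) (+-comm g 1)) a≤g+1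
a≤g+h*a+1⇒a≤1+g (suc k) {a} h*a≤g _ =
  ≤-trans (m≤m+n a (k * a)) (≤-trans h*a≤g (n≤1+n _))

conditions⇒reflective : ∀ F a →
  (2 ≤ a × a ≤ F + 1) × ¬ a ∣ F × 2 ∣ floorDiv F a →
  Σ NumericalSemigroup (λ S → Reflective S × IsFrobenius S F × IsMultiplicity S a)
conditions⇒reflective F a@(suc _) ((_ , a≤F+1) , a∤F , divides h F/a≡h*2) =
  semigroup , reflective ,
  subst (IsFrobenius semigroup) (sym F≡g+h*a) (frobenius h h*a<g g<h*a+a) ,
  multiplicity z<s
    (a≤g+h*a+1⇒a≤1+g h (<⇒≤ h*a<g) (subst (λ n → a ≤ n + 1) F≡g+h*a a≤F+1))
  where
  r g : ℕ
  r = F % a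
  g = h * a + r
  F≡g+h*a : F ≡ g + h * a
  F≡g+h*a = begin
    F                  ≡⟨ m≡m%n+[m/n]*n F a ⟩
    r + F / a * a      ≡⟨ cong (λ q → r + q * a) F/a≡h*2 ⟩
    r + h * 2 * a      ≡⟨ regroup r h a ⟩
    h * a + r + h * a  ∎
    where
    open ≡-Reasoning
    regroup : ∀ r h a → r + h * 2 * a ≡ h * a + r + h * a
    regroup = solve-∀
  a∤g : ¬ a ∣ g
  a∤g a∣g = a∤F (subst (a ∣_) (sym F≡g+h*a) (∣m∣n⇒∣m+n a∣g (divides h refl)))
  open Construction a g a∤g
  h*a<g : h * a < g
  h*a<g = m<m+n (h * a) (n≢0⇒n>0 (a∤F ∘ m%n≡0⇒n∣m F a))
  g<h*a+a : g < h * a + a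
  g<h*a+a = +-monoʳ-< (h * a) (m%n<n F a)

proposition5p6 : (F a : ℕ) →
    (Σ NumericalSemigroup (λ S → Reflective S × IsFrobenius S F × IsMultiplicity S a))
      ⇔ ((2 ≤ a × a ≤ F + 1) × (¬ (a ∣ F)) × (2 ∣ floorDiv F a))
proposition5p6 F a = mk⇔
  (λ (S , reflective , frobenius , multiplicity) →
     reflective⇒conditions {S = S} reflective frobenius multiplicity)
  (conditions⇒reflective F a)
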